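{- Let $n>11$ be an integer, $r=n-4$, let $G$ be an $r$-regular graph with $V(G)=\{v_1,\dots,v_n\}$ and $E(G)=\{e_1,\dots,e_m\}$, and let $H$ be the bipartite graph constructed from $G$ as in the context. Let $k$ be a positive integer with $k<n/2$, and suppose $G$ contains no clique of size $k$. Let $x=m-\left(kr-\binom{k}{2}\right)$. Then $$s_r(H)<s_{r-1}(H)<\cdots<s_k(H)<kr+x(r-1).$$
   Context: Construction of $H$: $H$ is bipartite with parts $A=\{a_1,\dots,a_m\}$ and $B=\beta\cup\Pi$, where $\beta=\{b_1,\dots,b_n\}$ and $\Pi=\{p_{i,j}: i\in[m], j\in[r-3]\}$; $E(H)=\{a_ip_{i,j}: i\in[m], j\in[r-3]\}\cup\{a_ib_j: e_i \text{ is incident to } v_j \text{ in } G\}$. For a vertex set $I$ of $H$, $\|I\|$ denotes the number of edges of $H$ with at least one endpoint in $I$. For an integer $i$ with $0\le i\le r-k$, let $\mathcal{I}_{k+i}$ be the family of independent sets $I\subseteq V(H)$ with $|I|=k+x$ and $|I\cap\beta|=k+i$, and $s_{k+i}(H)=\max\{\|I\| : I\in\mathcal{I}_{k+i}\}$. $[N]=\{1,\dots,N\}$. -}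

module Defs where

open import Data.Nat using (ℕ; zero; suc; _+_; _*_; _∸_; _≤_; _<_)
open import Data.Nat.Combinatorics using (_C_)
open import Data.Fin using (Fin; toℕ)
open import Data.Fin.Subset using (Subset; ∣_∣) renaming (_∈_ to _∈ₛ_)
open import Data.Bool using (Bool; true; false; _∨_; _∧_)
open import Data.List using (List; []; _∷_; map; _++_; length; filterᵇ; concatMap; allFin)
open import Data.List.Membership.Propositional using (_∈_)
open import Data.Product using (Σ; ∃; ∃-syntax; _×_; _,_; proj₁; proj₂)
open import Data.Sum using (_⊎_)
open import Relation.Binary.PropositionalEquality using (_≡_; _≢_)
open import Relation.Nullary using (¬_; does)
open import Relation.Nullary.Decidable using (_⊎-dec_)
import Data.Fin as F

-- Edge e_i joins the vertices  proj₁ (edge i)  and  proj₂ (edge i);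
-- endpoints are stored in increasing order (so no loops) and the
-- enumeration is injective (so no repeated edges).

record SimpleGraph (n : ℕ) : Set where
  field
    m       : ℕ
    edge    : Fin m → Fin n × Fin n
    ordered : ∀ i → toℕ (proj₁ (edge i)) < toℕ (proj₂ (edge i))
    inj     : ∀ i j → edge i ≡ edge j → i ≡ j

open SimpleGraph public

module _ {n : ℕ} (G : SimpleGraph n) where

  Incident : Fin (m G) → Fin n → Set
  Incident i v = proj₁ (edge G i) ≡ v ⊎ proj₂ (edge G i) ≡ v

  incident? : Fin (m G) → Fin n → Bool
  incident? i v = does ((proj₁ (edge G i) F.≟ v) ⊎-dec (proj₂ (edge G i) F.≟ v))

  Adjacent : Fin n → Fin n → Set
  Adjacent u v = ∃[ i ] (edge G i ≡ (u , v) ⊎ edge G i ≡ (v , u))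

  degree : Fin n → ℕ
  degree v = length (filterᵇ (λ i → incident? i v) (allFin (m G)))

  Regular : ℕ → Set
  Regular r = ∀ v → degree v ≡ r

  HasClique : ℕ → Set
  HasClique k = ∃[ S ] (∣ S ∣ ≡ k ×
                  (∀ u v → u ∈ₛ S → v ∈ₛ S → u ≢ v → Adjacent u v))

-- The bipartite graph H built from G, with q = r - 3 pendant vertices
-- p_{i,1},…,p_{i,q} attached to each a_i.

data VH (m n q : ℕ) : Set where
  a : Fin m → VH m n q
  b : Fin n → VH m n q
  p : Fin m → Fin q → VH m n q

module _ {n : ℕ} (G : SimpleGraph n) (q : ℕ) where

  V : Set
  V = VH (m G) n q

  vertsH : List V
  vertsH = map a (allFin (m G)) ++ map b (allFin n)
           ++ concatMap (λ i → map (p i) (allFin q)) (allFin (m G))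

  -- E(H) = { a_i p_{i,j} } ∪ { a_i b_j : e_i incident to v_j }, listed
  -- without repetition, each edge as a pair of its endpoints
  edgesH : List (V × V)
  edgesH = concatMap (λ i → map (λ j → (a i , p i j)) (allFin q)) (allFin (m G))
           ++ concatMap (λ i → map (λ v → (a i , b v))
                                   (filterᵇ (incident? G i) (allFin n)))
                        (allFin (m G))

  VSet : Set
  VSet = V → Bool

  Independent : VSet → Set
  Independent I = ∀ {x y} → (x , y) ∈ edgesH → ¬ (I x ≡ true × I y ≡ true)

  size : VSet → ℕ
  size I = length (filterᵇ I vertsH)

  sizeβ : VSet → ℕ
  sizeβ I = length (filterᵇ (λ v → I (b v)) (allFin n))

  ‖_‖ : VSet → ℕ
  ‖ I ‖ = length (filterᵇ (λ xy → I (proj₁ xy) ∨ I (proj₂ xy)) edgesH)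

  InFamily : (k x j : ℕ) → VSet → Set
  InFamily k x j I = Independent I × size I ≡ k + x × sizeβ I ≡ j

  IsMaxS : (k x j s : ℕ) → Set
  IsMaxS k x j s = (∃[ I ] (InFamily k x j I × ‖ I ‖ ≡ s))
                 × (∀ I → InFamily k x j I → ‖ I ‖ ≤ s)

-- x = m - (k r - binom(k,2))   (nonnegative under the hypotheses)
xval : ℕ → ℕ → ℕ → ℕ
xval m k r = m ∸ (k * r ∸ (k C 2))

module Submission where

-- Write c(B) for the number of edges of G avoiding a vertex
-- set B of G, and c_j for the largest c(B) over j-sets B.
--  * An independent set I of H with α vertices in A, π in Π and β in β has
--    |I| = α + β + π and ‖I‖ = α(q+2) + π + βr, where q = r - 3 (pendants),
--    2 (ends of an edge) and r (regularity) are the degrees; moreover α ≤ c(I ∩ β).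
--  * Conversely, for every B and every N ≤ (m - c(B))q there is an independent
--    set with I ∩ β = B, α = c(B) and π = N.  Trading pendants for A-vertices
--    never lowers ‖I‖, hence s_j = c_j(q+2) + N_j + jr with N_j = k + x - j - c_j.
--  * Deleting v ∈ B gives c(B - v) = c(B) + r - deg_B(v), and deg_B(v) ≤ |B| - 2
--    when B contains a non-neighbour of v.  Without a k-clique every set of
--    size ≥ k has such a pair, so c_{j+1} + 2 ≤ c_j for j ≥ k, and the counting
--    bound c(B) + |B|r ≤ m + C(|B|,2) becomes strict, giving c_k < x.
--  * Both facts together with r ≤ 2q + 2 make the sequence s_j decrease and
--    keep s_k below kr + x(r-1).

open import Defs
open import Data.Bool using (Bool; true; false; _∨_; _∧_; not; T?)
import Data.Bool as Bool
open import Data.Bool.Properties using (∧-conicalˡ; ∧-conicalʳ; ∧-zeroʳ; ∧-identityʳ; ∨-zeroʳ; T-≡)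
open import Data.Empty using (⊥; ⊥-elim)
open import Data.Fin using (Fin; zero; suc; toℕ)
open import Data.List using (List; []; _∷_; map; _++_; length; filter; filterᵇ; concatMap; allFin)
open import Data.List.Properties using (length-++; filter-++; length-filter; map-tabulate; length-tabulate)
open import Data.List.Relation.Unary.All as All using (All; []; _∷_)
import Data.List.Relation.Unary.Any as Any
open import Data.List.Membership.Propositional using (_∈_; find; lose)
open import Data.List.Membership.Propositional.Properties using (∈-++⁻; ∈-++⁺ˡ; ∈-++⁺ʳ; ∈-concatMap⁻; ∈-concatMap⁺; ∈-map⁻; ∈-map⁺; ∈-filter⁻; ∈-filter⁺; ∈-allFin)
open import Function.Bundles using (Equivalence)
open import Data.Fin.Subset using (Subset; ∣_∣) renaming (_∈_ to _∈ₛ_)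
open import Data.Vec using (Vec; _∷_; []; _[_]=_; there; lookup)
import Data.Vec as Vec
open import Data.Vec.Properties using (lookup∘tabulate)
open import Data.List.Extrema.Nat using (argmax; argmax-all; f[xs]≤f[argmax])
open import Data.Nat.Combinatorics using (_C_; nCk+nC[k+1]≡[n+1]C[k+1]; nC1≡n)
open import Data.Nat.Tactic.RingSolver using (solve-∀)
open import Data.Product.Properties using (≡-dec)
open import Relation.Nullary.Decidable using (Dec; _×-dec_; _⊎-dec_; ¬?)
open import Data.Nat using (ℕ; zero; suc; _+_; _*_; _∸_; _≤_; _<_; z≤n; s≤s; _<ᵇ_; _⊓_; _≟_; >-nonZero)
open import Data.Nat.Properties
open import Algebra.Properties.CommutativeSemigroup +-commutativeSemigroup using (interchange; xy∙z≈xz∙y; xy∙z≈x∙zy; x∙yz≈y∙xz)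
open import Data.Product using (Σ; ∃; ∃₂; _×_; _,_; proj₁; proj₂)
open import Data.Sum using (_⊎_; inj₁; inj₂)
import Data.Sum as Sum
open import Function using (_∘_; id)
open import Relation.Binary.PropositionalEquality
open import Relation.Nullary using (¬_; does; yes; no)
import Data.Fin as F
import Data.Fin.Properties as FP

𝟙 : Bool → ℕ
𝟙 true  = 1
𝟙 false = 0

𝟙-≤ : ∀ b c → (b ≡ true → c ≡ true) → 𝟙 b ≤ 𝟙 c
𝟙-≤ true  c h rewrite h refl = ≤-refl
𝟙-≤ false c h = z≤n

𝟙-∨ : ∀ b c → b ∧ c ≡ false → 𝟙 (b ∨ c) ≡ 𝟙 b + 𝟙 c
𝟙-∨ true  false _ = refl
𝟙-∨ false c     _ = refl

module _ {A : Set} where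

  count : (A → Bool) → List A → ℕ
  count f L = length (filterᵇ f L)

  sumL : (A → ℕ) → List A → ℕ
  sumL h []      = 0
  sumL h (x ∷ L) = h x + sumL h L

  count-∷ : (f : A → Bool) (x : A) (L : List A) → count f (x ∷ L) ≡ 𝟙 (f x) + count f L
  count-∷ f x L with f x
  ... | true  = refl
  ... | false = refl

  count≡sum : (f : A → Bool) (L : List A) → count f L ≡ sumL (𝟙 ∘ f) L
  count≡sum f []      = refl
  count≡sum f (x ∷ L) = trans (count-∷ f x L) (cong (𝟙 (f x) +_) (count≡sum f L))

  sumL-cong : {h h′ : A → ℕ} (L : List A) → (∀ x → h x ≡ h′ x) → sumL h L ≡ sumL h′ L
  sumL-cong []      e = refl
  sumL-cong (x ∷ L) e = cong₂ _+_ (e x) (sumL-cong L e)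

  sumL-+ : (h h′ : A → ℕ) (L : List A) → sumL (λ x → h x + h′ x) L ≡ sumL h L + sumL h′ L
  sumL-+ h h′ []      = refl
  sumL-+ h h′ (x ∷ L) =
    trans (cong (h x + h′ x +_) (sumL-+ h h′ L)) (interchange (h x) (h′ x) (sumL h L) (sumL h′ L))

  sumL-* : (c : ℕ) (h : A → ℕ) (L : List A) → sumL (λ x → h x * c) L ≡ sumL h L * c
  sumL-* c h []      = refl
  sumL-* c h (x ∷ L) = trans (cong (h x * c +_) (sumL-* c h L)) (sym (*-distribʳ-+ c (h x) (sumL h L)))

  count-cong : {f g : A → Bool} (L : List A) → (∀ x → f x ≡ g x) → count f L ≡ count g L
  count-cong {f} {g} L e =
    trans (count≡sum f L) (trans (sumL-cong L (cong 𝟙 ∘ e)) (sym (count≡sum g L)))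

  count-++ : (f : A → Bool) (L M : List A) → count f (L ++ M) ≡ count f L + count f M
  count-++ f L M = trans (cong length (filter-++ (T? ∘ f) L M)) (length-++ (filterᵇ f L))

  count-≤-length : (f : A → Bool) (L : List A) → count f L ≤ length L
  count-≤-length f = length-filter (T? ∘ f)

  count-≤ : (f g : A → Bool) (L : List A) → (∀ x → f x ≡ true → g x ≡ true) → count f L ≤ count g L
  count-≤ f g []      h = z≤n
  count-≤ f g (x ∷ L) h = begin
    count f (x ∷ L)          ≡⟨ count-∷ f x L ⟩
    𝟙 (f x) + count f L      ≤⟨ +-mono-≤ (𝟙-≤ (f x) (g x) (h x)) (count-≤ f g L h) ⟩
    𝟙 (g x) + count g L      ≡⟨ count-∷ g x L ⟨
    count g (x ∷ L)          ∎
    where open ≤-Reasoning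

  count-∨ : (f g : A → Bool) (L : List A) → All (λ x → f x ∧ g x ≡ false) L →
            count (λ x → f x ∨ g x) L ≡ count f L + count g L
  count-∨ f g []      []       = refl
  count-∨ f g (x ∷ L) (d ∷ ds) = begin
    count (λ x → f x ∨ g x) (x ∷ L)                ≡⟨ count-∷ _ x L ⟩
    𝟙 (f x ∨ g x) + count (λ x → f x ∨ g x) L      ≡⟨ cong₂ _+_ (𝟙-∨ (f x) (g x) d) (count-∨ f g L ds) ⟩
    (𝟙 (f x) + 𝟙 (g x)) + (count f L + count g L)  ≡⟨ interchange (𝟙 (f x)) _ _ _ ⟩
    (𝟙 (f x) + count f L) + (𝟙 (g x) + count g L)  ≡⟨ cong₂ _+_ (count-∷ f x L) (count-∷ g x L) ⟨
    count f (x ∷ L) + count g (x ∷ L)              ∎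
    where open ≡-Reasoning

  count-split : (f g : A → Bool) (L : List A) →
                count f L ≡ count (λ x → f x ∧ g x) L + count (λ x → f x ∧ not (g x)) L
  count-split f g L = trans (count-cong L split) (count-∨ _ _ L (All.universal disjoint L))
    where
    split : ∀ x → f x ≡ (f x ∧ g x) ∨ (f x ∧ not (g x))
    split x with f x | g x
    ... | true  | true  = refl
    ... | true  | false = refl
    ... | false | _     = refl
    disjoint : ∀ x → (f x ∧ g x) ∧ (f x ∧ not (g x)) ≡ false
    disjoint x with f x | g x
    ... | true  | true  = refl
    ... | true  | false = refl
    ... | false | _     = refl

  count-const : (c : Bool) (L : List A) → count (λ _ → c) L ≡ 𝟙 c * length L
  count-const c L = trans (count≡sum _ L) (constSum L)
    where
    constSum : (L : List A) → sumL (λ _ → 𝟙 c) L ≡ 𝟙 c * length L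
    constSum []      = sym (*-zeroʳ (𝟙 c))
    constSum (x ∷ L) = trans (cong (𝟙 c +_) (constSum L)) (sym (*-suc (𝟙 c) (length L)))

  count-filter : (f g : A → Bool) (L : List A) → count f (filterᵇ g L) ≡ count (λ x → g x ∧ f x) L
  count-filter f g []      = refl
  count-filter f g (x ∷ L) = trans (step (g x) refl) (sym (count-∷ (λ y → g y ∧ f y) x L))
    where
    step : (b : Bool) → g x ≡ b → count f (filterᵇ g (x ∷ L)) ≡ 𝟙 (b ∧ f x) + count (λ y → g y ∧ f y) L
    step true  e rewrite e = trans (count-∷ f x _) (cong (𝟙 (f x) +_) (count-filter f g L))
    step false e rewrite e = count-filter f g L

module _ {A A′ : Set} where

  count-map : (f : A′ → Bool) (g : A → A′) (L : List A) → count f (map g L) ≡ count (f ∘ g) L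
  count-map f g []      = refl
  count-map f g (x ∷ L) = trans (count-∷ f (g x) _) (trans (cong (𝟙 (f (g x)) +_) (count-map f g L)) (sym (count-∷ (f ∘ g) x L)))

  sumL-map : (h : A′ → ℕ) (g : A → A′) (L : List A) → sumL h (map g L) ≡ sumL (h ∘ g) L
  sumL-map h g []      = refl
  sumL-map h g (x ∷ L) = cong (h (g x) +_) (sumL-map h g L)

  count-concatMap : (f : A′ → Bool) (g : A → List A′) (L : List A) →
                    count f (concatMap g L) ≡ sumL (λ x → count f (g x)) L
  count-concatMap f g []      = refl
  count-concatMap f g (x ∷ L) = trans (count-++ f (g x) _) (cong (count f (g x) +_) (count-concatMap f g L))

  count-fibres : (f : A → Bool) (g : A → List A′) (h : A′ → Bool) (c : ℕ) (L : List A) →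
                 (∀ x → count h (g x) ≡ 𝟙 (f x) * c) → count h (concatMap g L) ≡ count f L * c
  count-fibres f g h c L fibre = begin
    count h (concatMap g L)          ≡⟨ count-concatMap h g L ⟩
    sumL (λ x → count h (g x)) L     ≡⟨ sumL-cong L fibre ⟩
    sumL (λ x → 𝟙 (f x) * c) L       ≡⟨ sumL-* c (𝟙 ∘ f) L ⟩
    sumL (𝟙 ∘ f) L * c               ≡⟨ cong (_* c) (count≡sum f L) ⟨
    count f L * c                    ∎
    where open ≡-Reasoning

  double-count : (R : A → A′ → Bool) (L : List A) (M : List A′) →
                 sumL (λ x → count (R x) M) L ≡ sumL (λ y → count (λ x → R x y) L) M
  double-count R []      M = sym (zeros M)
    where
    zeros : (M : List A′) → sumL (λ _ → 0) M ≡ 0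
    zeros []      = refl
    zeros (_ ∷ M) = zeros M
  double-count R (x ∷ L) M = begin
    count (R x) M + sumL (λ x → count (R x) M) L                 ≡⟨ cong₂ _+_ (count≡sum (R x) M) (double-count R L M) ⟩
    sumL (𝟙 ∘ R x) M + sumL (λ y → count (λ x → R x y) L) M      ≡⟨ sumL-+ _ _ M ⟨
    sumL (λ y → 𝟙 (R x y) + count (λ x → R x y) L) M             ≡⟨ sumL-cong M (λ y → sym (count-∷ (λ x → R x y) x L)) ⟩
    sumL (λ y → count (λ x → R x y) (x ∷ L)) M                   ∎
    where open ≡-Reasoning

countF : {n : ℕ} → (Fin n → Bool) → ℕ
countF {n} f = count f (allFin n)

length-allFin : (n : ℕ) → length (allFin n) ≡ n
length-allFin n = length-tabulate id

countF-suc : {n : ℕ} (f : Fin (suc n) → Bool) → countF f ≡ 𝟙 (f zero) + countF (f ∘ suc)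
countF-suc {n} f = trans (count-∷ f zero _)
  (cong (𝟙 (f zero) +_) (trans (cong (count f) (sym (map-tabulate id suc))) (count-map f suc (allFin n))))

sumF-suc : {n : ℕ} (h : Fin (suc n) → ℕ) → sumL h (allFin (suc n)) ≡ h zero + sumL (h ∘ suc) (allFin n)
sumF-suc {n} h = cong (h zero +_) (trans (cong (sumL h) (sym (map-tabulate id suc))) (sumL-map h suc (allFin n)))

witness : {n t : ℕ} (B : Fin n → Bool) → countF B ≡ suc t → ∃ λ v → B v ≡ true
witness {n} B size with FP.any? (λ v → B v Bool.≟ true)
... | yes found = found
... | no none   = ⊥-elim (n≮0 (subst (_≤ 0) size
                    (≤-trans (count-≤ B (λ _ → false) (allFin n) noElement) (≤-reflexive (count-const false (allFin n))))))
  where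
  noElement : ∀ v → B v ≡ true → false ≡ true
  noElement v Bv = ⊥-elim (none (v , Bv))

_≡ᵇ_ : {n : ℕ} → Fin n → Fin n → Bool
u ≡ᵇ v = does (u F.≟ v)

≡ᵇ-refl : {n : ℕ} (v : Fin n) → (v ≡ᵇ v) ≡ true
≡ᵇ-refl zero    = refl
≡ᵇ-refl (suc v) = ≡ᵇ-refl v

≢⇒≡ᵇ-false : {n : ℕ} {u v : Fin n} → ¬ u ≡ v → (u ≡ᵇ v) ≡ false
≢⇒≡ᵇ-false {u = u} {v} u≢v with u F.≟ v
... | yes u≡v = ⊥-elim (u≢v u≡v)
... | no  _   = refl

≡ᵇ-sym : {n : ℕ} (u v : Fin n) → (u ≡ᵇ v) ≡ (v ≡ᵇ u)
≡ᵇ-sym u v with u F.≟ v | v F.≟ u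
... | yes _   | yes _   = refl
... | no  _   | no  _   = refl
... | yes u≡v | no  v≢u = ⊥-elim (v≢u (sym u≡v))
... | no  u≢v | yes v≡u = ⊥-elim (u≢v (sym v≡u))

countF-single : {n : ℕ} (v : Fin n) → countF (_≡ᵇ v) ≡ 1
countF-single {suc n} zero    = trans (countF-suc {n} (_≡ᵇ zero)) (cong suc (count-const false (allFin n)))
countF-single {suc n} (suc v) = trans (countF-suc {n} (_≡ᵇ suc v)) (countF-single v)

countF-single′ : {n : ℕ} (v : Fin n) → countF (v ≡ᵇ_) ≡ 1
countF-single′ {n} v = trans (count-cong (allFin n) (≡ᵇ-sym v)) (countF-single v)

_─_ : {n : ℕ} → (Fin n → Bool) → Fin n → Fin n → Bool
(B ─ v) w = B w ∧ not (w ≡ᵇ v)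

─-keeps : {n : ℕ} (B : Fin n → Bool) {v w : Fin n} → B w ≡ true → ¬ w ≡ v → (B ─ v) w ≡ true
─-keeps B Bw w≢v rewrite Bw | ≢⇒≡ᵇ-false w≢v = refl

countF-─ : {n : ℕ} (B : Fin n → Bool) (v : Fin n) → B v ≡ true → countF B ≡ suc (countF (B ─ v))
countF-─ {n} B v Bv = trans (count-split B (_≡ᵇ v) (allFin n))
  (cong (_+ countF (B ─ v)) (trans (count-cong (allFin n) only-v) (countF-single v)))
  where
  only-v : ∀ w → (B w ∧ (w ≡ᵇ v)) ≡ (w ≡ᵇ v)
  only-v w with w F.≟ v
  ... | yes refl = cong (_∧ true) Bv
  ... | no  _    = ∧-zeroʳ (B w)

countF-initial : (q g : ℕ) → g ≤ q → countF {q} (λ t → toℕ t <ᵇ g) ≡ g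
countF-initial zero    zero    z≤n     = refl
countF-initial (suc q) zero    _       = count-const false (allFin (suc q))
countF-initial (suc q) (suc g) (s≤s g≤q) =
  trans (countF-suc {q} (λ t → toℕ t <ᵇ suc g)) (cong suc (countF-initial q g g≤q))

countF-─-size : {n t : ℕ} (B : Fin n → Bool) (v : Fin n) → B v ≡ true → countF B ≡ suc t → countF (B ─ v) ≡ t
countF-─-size B v Bv size = suc-injective (trans (sym (countF-─ B v Bv)) size)

pigeonhole : {m n : ℕ} (P : Fin m → Bool) (Q : Fin n → Bool) (f : Fin m → Fin n) →
             (∀ i → P i ≡ true → Q (f i) ≡ true) →
             (∀ i j → P i ≡ true → P j ≡ true → f i ≡ f j → i ≡ j) →
             countF P ≤ countF Q
pigeonhole {zero}  P Q f into inj = z≤n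
pigeonhole {suc m} P Q f into inj = byFirst (P zero) refl
  where
  unfoldP : ∀ {b} → P zero ≡ b → countF P ≡ 𝟙 b + countF (P ∘ suc)
  unfoldP P₀ = trans (countF-suc P) (cong (λ b → 𝟙 b + _) P₀)
  inj′ : ∀ i j → P (suc i) ≡ true → P (suc j) ≡ true → f (suc i) ≡ f (suc j) → i ≡ j
  inj′ i j Pi Pj e = FP.suc-injective (inj (suc i) (suc j) Pi Pj e)
  byFirst : (b : Bool) → P zero ≡ b → countF P ≤ countF Q
  byFirst false P₀ = subst (_≤ countF Q) (sym (unfoldP P₀)) (pigeonhole (P ∘ suc) Q (f ∘ suc) (into ∘ suc) inj′)
  byFirst true  P₀ = subst₂ _≤_ (sym (unfoldP P₀)) (sym (countF-─ Q (f zero) (into zero P₀)))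
                       (s≤s (pigeonhole (P ∘ suc) (Q ─ f zero) (f ∘ suc) into′ inj′))
    where
    -- f zero is taken, so the rest of P lands in Q ─ f zero
    into′ : ∀ i → P (suc i) ≡ true → (Q ─ f zero) (f (suc i)) ≡ true
    into′ i Pi = ─-keeps Q (into (suc i) Pi) (λ e → FP.0≢1+n (inj zero (suc i) P₀ Pi (sym e)))

fill : {k : ℕ} → (Fin k → ℕ) → ℕ → Fin k → ℕ
fill cap N zero    = cap zero ⊓ N
fill cap N (suc i) = fill (cap ∘ suc) (N ∸ cap zero) i

fill-≤ : {k : ℕ} (cap : Fin k → ℕ) (N : ℕ) (i : Fin k) → fill cap N i ≤ cap i
fill-≤ cap N zero    = m⊓n≤m (cap zero) N
fill-≤ cap N (suc i) = fill-≤ (cap ∘ suc) (N ∸ cap zero) i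

fill-total : {k : ℕ} (cap : Fin k → ℕ) (N : ℕ) → N ≤ sumL cap (allFin k) → sumL (fill cap N) (allFin k) ≡ N
fill-total {zero}  cap zero    _     = refl
fill-total {suc k} cap N       N≤cap = begin
  sumL (fill cap N) (allFin (suc k))                        ≡⟨ sumF-suc (fill cap N) ⟩
  cap zero ⊓ N + sumL (fill (cap ∘ suc) (N ∸ cap zero)) (allFin k)
    ≡⟨ cong (cap zero ⊓ N +_) (fill-total (cap ∘ suc) (N ∸ cap zero) rest) ⟩
  cap zero ⊓ N + (N ∸ cap zero)                             ≡⟨ m⊓n+n∸m≡n (cap zero) N ⟩
  N                                                         ∎
  where
  open ≡-Reasoning
  rest : N ∸ cap zero ≤ sumL (cap ∘ suc) (allFin k)
  rest = m≤n+o⇒m∸n≤o N (cap zero) (subst (N ≤_) (sumF-suc cap) N≤cap)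

choose2-suc : (t : ℕ) → suc t C 2 ≡ t + t C 2
choose2-suc t = trans (sym (nCk+nC[k+1]≡[n+1]C[k+1] t 1)) (cong (_+ t C 2) (nC1≡n t))

choose2-≤ : (r t : ℕ) → t ≤ suc r → t C 2 ≤ t * r
choose2-≤ r zero    _     = z≤n
choose2-≤ r (suc t) t<r+1 = subst (_≤ suc t * r) (sym (choose2-suc t))
  (+-mono-≤ (≤-pred t<r+1) (choose2-≤ r t (m≤n⇒m≤1+n (≤-pred t<r+1))))

pick : {k : ℕ} → Bool → ℕ → (ℕ → Subset k) → Subset (suc k)
pick true  (suc t) rest = true ∷ rest t
pick true  zero    rest = false ∷ rest zero
pick false t       rest = false ∷ rest t

firstOf : {k : ℕ} → (Fin k → Bool) → ℕ → Subset k
firstOf {zero}  B t = []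
firstOf {suc k} B t = pick (B zero) t (firstOf (B ∘ suc))

firstOf-size : {k : ℕ} (B : Fin k → Bool) (t : ℕ) → t ≤ countF B → ∣ firstOf B t ∣ ≡ t
firstOf-size {zero}  B zero z≤n = refl
firstOf-size {suc k} B t t≤B = pickSize (B zero) t (subst (t ≤_) (countF-suc B) t≤B)
  where
  pickSize : (b : Bool) (t : ℕ) → t ≤ 𝟙 b + countF (B ∘ suc) → ∣ pick b t (firstOf (B ∘ suc)) ∣ ≡ t
  pickSize true  zero    _   = firstOf-size (B ∘ suc) zero z≤n
  pickSize true  (suc t) t≤B = cong suc (firstOf-size (B ∘ suc) t (≤-pred t≤B))
  pickSize false t       t≤B = firstOf-size (B ∘ suc) t t≤B

firstOf-⊆ : {k : ℕ} (B : Fin k → Bool) (t : ℕ) (x : Fin k) → x ∈ₛ firstOf B t → B x ≡ true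
firstOf-⊆ {suc k} B t x x∈ = pickMember (B zero) refl t x x∈
  where
  pickMember : (b : Bool) → B zero ≡ b → ∀ t x → pick b t (firstOf (B ∘ suc)) [ x ]= true → B x ≡ true
  pickMember true  B₀ (suc t) zero    _          = B₀
  pickMember true  B₀ (suc t) (suc x) (there x∈) = firstOf-⊆ (B ∘ suc) t x x∈
  pickMember true  B₀ zero    (suc x) (there x∈) = firstOf-⊆ (B ∘ suc) zero x x∈
  pickMember false B₀ t       (suc x) (there x∈) = firstOf-⊆ (B ∘ suc) t x x∈

module _ {n : ℕ} (G : SimpleGraph n) where

  end₁ end₂ : Fin (m G) → Fin n
  end₁ i = proj₁ (edge G i)
  end₂ i = proj₂ (edge G i)

  Joins : Fin (m G) → Fin n → Fin n → Set
  Joins i v w = edge G i ≡ (v , w) ⊎ edge G i ≡ (w , v)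

  ordered′ : ∀ {i u w} → edge G i ≡ (u , w) → toℕ u < toℕ w
  ordered′ {i} e = subst (λ uw → toℕ (proj₁ uw) < toℕ (proj₂ uw)) e (ordered G i)

  joins-≢ : ∀ {i v w} → Joins i v w → ¬ w ≡ v
  joins-≢ (inj₁ e) refl = <-irrefl refl (ordered′ e)
  joins-≢ (inj₂ e) refl = <-irrefl refl (ordered′ e)

  joins-unique : ∀ {i j v w} → Joins i v w → Joins j v w → i ≡ j
  joins-unique {i} {j} (inj₁ e) (inj₁ e′) = inj G i j (trans e (sym e′))
  joins-unique {i} {j} (inj₂ e) (inj₂ e′) = inj G i j (trans e (sym e′))
  joins-unique (inj₁ e) (inj₂ e′) = ⊥-elim (<-asym (ordered′ e) (ordered′ e′))
  joins-unique (inj₂ e) (inj₁ e′) = ⊥-elim (<-asym (ordered′ e) (ordered′ e′))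

  joins-adjacent : ∀ {i v w} → Joins i v w → Adjacent G w v
  joins-adjacent {i} j = i , Sum.swap j

  -- the endpoint of e_i other than v (meaningful when e_i is incident to v)
  other : Fin (m G) → Fin n → Fin n
  other i v with end₁ i F.≟ v
  ... | yes _ = end₂ i
  ... | no  _ = end₁ i

  joins-other : ∀ i v → incident? G i v ≡ true → Joins i v (other i v)
  joins-other i v inc with end₁ i F.≟ v
  ... | yes e = inj₁ (cong (_, end₂ i) e)
  ... | no  _ with end₂ i F.≟ v
  ...   | yes e = inj₂ (cong (end₁ i ,_) e)
  joins-other i v () | no _ | no _

  Avoids : (Fin n → Bool) → Fin (m G) → Bool
  Avoids B i = not (B (end₁ i)) ∧ not (B (end₂ i))

  avoiding : (Fin n → Bool) → ℕ
  avoiding B = countF (Avoids B)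

  avoiding-cong : {B B′ : Fin n → Bool} → (∀ w → B w ≡ B′ w) → avoiding B ≡ avoiding B′
  avoiding-cong e = count-cong (allFin (m G)) (λ i → cong₂ (λ x y → not x ∧ not y) (e (end₁ i)) (e (end₂ i)))

  Inside : (Fin n → Bool) → Fin (m G) → Bool
  Inside B i = B (end₁ i) ∧ B (end₂ i)

  joins-inside : ∀ {i v w} (B : Fin n → Bool) → Joins i v w → Inside B i ≡ true → B w ≡ true
  joins-inside B (inj₁ e) h = ∧-conicalʳ _ _ (subst (λ uw → B (proj₁ uw) ∧ B (proj₂ uw) ≡ true) e h)
  joins-inside B (inj₂ e) h = ∧-conicalˡ _ _ (subst (λ uw → B (proj₁ uw) ∧ B (proj₂ uw) ≡ true) e h)

  innerDegree : (Fin n → Bool) → Fin n → ℕ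
  innerDegree B v = countF (λ i → incident? G i v ∧ Inside B i)

  -- Every edge inside B at v leads to a distinct neighbour of v in B;
  -- so deg_B(v) is at most the size of any set S containing those neighbours.
  innerDegree-≤ : (B S : Fin n → Bool) (v : Fin n) →
                  (∀ w → B w ≡ true → ¬ w ≡ v → Adjacent G w v → S w ≡ true) →
                  innerDegree B v ≤ countF S
  innerDegree-≤ B S v nbrs = pigeonhole _ S (λ i → other i v) into unique
    where
    into : ∀ i → (incident? G i v ∧ Inside B i) ≡ true → S (other i v) ≡ true
    into i h = nbrs _ (joins-inside B j (∧-conicalʳ (incident? G i v) _ h)) (joins-≢ j) (joins-adjacent j)
      where j = joins-other i v (∧-conicalˡ _ _ h)
    unique : ∀ i i′ → (incident? G i v ∧ Inside B i) ≡ true → (incident? G i′ v ∧ Inside B i′) ≡ true →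
             other i v ≡ other i′ v → i ≡ i′
    unique i i′ h h′ e = joins-unique (joins-other i v (∧-conicalˡ _ _ h))
                           (subst (Joins i′ v) (sym e) (joins-other i′ v (∧-conicalˡ _ _ h′)))

  innerDegree-<  : (B : Fin n → Bool) (v : Fin n) → B v ≡ true → suc (innerDegree B v) ≤ countF B
  innerDegree-< B v Bv = subst (suc (innerDegree B v) ≤_) (sym (countF-─ B v Bv))
    (s≤s (innerDegree-≤ B (B ─ v) v (λ w Bw w≢v _ → ─-keeps B Bw w≢v)))

  innerDegree-<-nonadjacent : (B : Fin n → Bool) (u v : Fin n) → B u ≡ true → B v ≡ true →
                              ¬ u ≡ v → ¬ Adjacent G u v → suc (suc (innerDegree B v)) ≤ countF B
  innerDegree-<-nonadjacent B u v Bu Bv u≢v u≁v =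
    subst (suc (suc (innerDegree B v)) ≤_) (sym (trans (countF-─ B v Bv) (cong suc (countF-─ (B ─ v) u (─-keeps B Bu u≢v)))))
      (s≤s (s≤s (innerDegree-≤ B ((B ─ v) ─ u) v keep)))
    where
    keep : ∀ w → B w ≡ true → ¬ w ≡ v → Adjacent G w v → ((B ─ v) ─ u) w ≡ true
    keep w Bw w≢v w∼v = ─-keeps (B ─ v) (─-keeps B Bw w≢v) (λ { refl → u≁v w∼v })

  avoids-─ : (B : Fin n → Bool) (v : Fin n) → B v ≡ true → ∀ i →
             Avoids (B ─ v) i ≡ Avoids B i ∨ (incident? G i v ∧ not (Inside B i))
  avoids-─ B v Bv i = cases (end₁ i) (end₂ i) (λ e → joins-≢ {i} (inj₁ refl) (sym e))
    where
    cases : ∀ x y → ¬ x ≡ y → not ((B ─ v) x) ∧ not ((B ─ v) y) ≡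
            (not (B x) ∧ not (B y)) ∨ (((x ≡ᵇ v) ∨ (y ≡ᵇ v)) ∧ not (B x ∧ B y))
    cases x y x≢y with x F.≟ v | y F.≟ v
    ... | yes refl | yes refl = ⊥-elim (x≢y refl)
    ... | yes refl | no _ rewrite Bv with B y
    ...   | true  = refl
    ...   | false = refl
    cases x y x≢y | no _ | yes refl rewrite Bv with B x
    ...   | true  = refl
    ...   | false = refl
    cases x y x≢y | no _ | no _ with B x | B y
    ...   | true  | true  = refl
    ...   | true  | false = refl
    ...   | false | true  = refl
    ...   | false | false = refl

  avoids-─-disjoint : (B : Fin n → Bool) (v : Fin n) → B v ≡ true → ∀ i →
                      Avoids B i ∧ (incident? G i v ∧ not (Inside B i)) ≡ false
  avoids-─-disjoint B v Bv i = cases (end₁ i) (end₂ i)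
    where
    cases : ∀ x y → (not (B x) ∧ not (B y)) ∧ (((x ≡ᵇ v) ∨ (y ≡ᵇ v)) ∧ not (B x ∧ B y)) ≡ false
    cases x y with x F.≟ v | y F.≟ v
    ... | yes refl | _ rewrite Bv = refl
    ... | no _ | yes refl rewrite Bv with B x
    ...   | true  = refl
    ...   | false = refl
    cases x y | no _ | no _ with B x | B y
    ...   | true  | _     = refl
    ...   | false | true  = refl
    ...   | false | false = refl

  avoiding-─ : (r : ℕ) → Regular G r → (B : Fin n → Bool) (v : Fin n) → B v ≡ true →
               avoiding (B ─ v) + innerDegree B v ≡ avoiding B + r
  avoiding-─ r reg B v Bv = begin
    avoiding (B ─ v) + innerDegree B v
      ≡⟨ cong (_+ innerDegree B v) (trans (count-cong (allFin (m G)) (avoids-─ B v Bv))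
           (count-∨ (Avoids B) Outward (allFin (m G)) (All.universal (avoids-─-disjoint B v Bv) _))) ⟩
    avoiding B + countF Outward + innerDegree B v
      ≡⟨ +-assoc (avoiding B) _ _ ⟩
    avoiding B + (countF Outward + innerDegree B v)
      ≡⟨ cong (avoiding B +_) (+-comm (countF Outward) _) ⟩
    avoiding B + (innerDegree B v + countF Outward)
      ≡⟨ cong (avoiding B +_) (count-split (λ i → incident? G i v) (Inside B) (allFin (m G))) ⟨
    avoiding B + degree G v
      ≡⟨ cong (avoiding B +_) (reg v) ⟩
    avoiding B + r ∎
    where
    open ≡-Reasoning
    Outward : Fin (m G) → Bool
    Outward i = incident? G i v ∧ not (Inside B i)

  avoiding-─-≤ : (r : ℕ) → Regular G r → (B : Fin n → Bool) (v : Fin n) → B v ≡ true →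
                 (d e : ℕ) → d + innerDegree B v ≤ e → avoiding B + r + d ≤ avoiding (B ─ v) + e
  avoiding-─-≤ r reg B v Bv d e small = begin
    avoiding B + r + d                      ≡⟨ cong (_+ d) (avoiding-─ r reg B v Bv) ⟨
    avoiding (B ─ v) + innerDegree B v + d  ≡⟨ +-assoc (avoiding (B ─ v)) _ d ⟩
    avoiding (B ─ v) + (innerDegree B v + d) ≤⟨ +-monoʳ-≤ (avoiding (B ─ v)) (subst (_≤ e) (+-comm d _) small) ⟩
    avoiding (B ─ v) + e                    ∎
    where open ≤-Reasoning

  -- One deletion step of the bound  c(B) + |B| r ≤ m + C(|B|, 2),  with a
  -- surplus d when v has at most |B| - 1 - d neighbours in B.
  bound-step : (r : ℕ) → Regular G r → (t d : ℕ) (B : Fin n → Bool) (v : Fin n) → B v ≡ true →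
               d + innerDegree B v ≤ t →
               avoiding (B ─ v) + t * r ≤ m G + t C 2 →
               d + (avoiding B + suc t * r) ≤ m G + suc t C 2
  bound-step r reg t d B v Bv small rest = begin
    d + (avoiding B + (r + t * r))  ≡⟨ regroup d (avoiding B) r (t * r) ⟩
    avoiding B + r + d + t * r      ≤⟨ +-monoˡ-≤ (t * r) (avoiding-─-≤ r reg B v Bv d t small) ⟩
    avoiding (B ─ v) + t + t * r    ≡⟨ xy∙z≈xz∙y (avoiding (B ─ v)) t (t * r) ⟩
    avoiding (B ─ v) + t * r + t    ≤⟨ +-monoˡ-≤ t rest ⟩
    m G + t C 2 + t                 ≡⟨ trans (+-assoc (m G) _ t) (cong (m G +_) (trans (+-comm _ t) (sym (choose2-suc t)))) ⟩
    m G + suc t C 2                 ∎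
    where
    open ≤-Reasoning
    regroup : ∀ d a r s → d + (a + (r + s)) ≡ a + r + d + s
    regroup = solve-∀

  -- c(B) + |B| r ≤ m + C(|B|, 2): delete the vertices of B one at a time.
  avoiding-bound : (r : ℕ) → Regular G r → (t : ℕ) (B : Fin n → Bool) → countF B ≡ t →
                   avoiding B + t * r ≤ m G + t C 2
  avoiding-bound r reg zero    B _ =
    +-monoˡ-≤ 0 (subst (avoiding B ≤_) (length-allFin (m G)) (count-≤-length (Avoids B) (allFin (m G))))
  avoiding-bound r reg (suc t) B size with witness B size
  ... | v , Bv = bound-step r reg t 0 B v Bv (≤-pred (subst (suc (innerDegree B v) ≤_) size (innerDegree-< B v Bv)))
                   (avoiding-bound r reg t (B ─ v) (countF-─-size B v Bv size))

  avoiding-bound-strict : (r : ℕ) → Regular G r → (t : ℕ) (B : Fin n → Bool) (u v : Fin n) →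
                          countF B ≡ suc t → B u ≡ true → B v ≡ true → ¬ u ≡ v → ¬ Adjacent G u v →
                          suc (avoiding B + suc t * r) ≤ m G + suc t C 2
  avoiding-bound-strict r reg t B u v size Bu Bv u≢v u≁v =
    bound-step r reg t 1 B v Bv (≤-pred (subst (suc (suc (innerDegree B v)) ≤_) size (innerDegree-<-nonadjacent B u v Bu Bv u≢v u≁v)))
      (avoiding-bound r reg t (B ─ v) (countF-─-size B v Bv size))

  adjacent? : (u v : Fin n) → Dec (Adjacent G u v)
  adjacent? u v = FP.any? (λ i → ≡-dec F._≟_ F._≟_ (edge G i) (u , v) ⊎-dec ≡-dec F._≟_ F._≟_ (edge G i) (v , u))

  NonadjacentIn : (Fin n → Bool) → Fin n → Fin n → Set
  NonadjacentIn B u v = B u ≡ true × B v ≡ true × ¬ u ≡ v × ¬ Adjacent G u v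

  -- Without a k-clique, every vertex set with at least k elements contains two
  -- distinct non-adjacent vertices (otherwise its first k elements form a clique).
  nonadjacent-pair : (k : ℕ) (B : Fin n → Bool) → k ≤ countF B → ¬ HasClique G k → ∃₂ (NonadjacentIn B)
  nonadjacent-pair k B k≤B noClique with FP.any? (λ u → FP.any? (λ v → nonadjacent? u v))
    where
    nonadjacent? : ∀ u v → Dec (NonadjacentIn B u v)
    nonadjacent? u v = (B u Bool.≟ true) ×-dec (B v Bool.≟ true) ×-dec ¬? (u F.≟ v) ×-dec ¬? (adjacent? u v)
  ... | yes (u , v , pair) = u , v , pair
  ... | no  none = ⊥-elim (noClique (firstOf B k , firstOf-size B k k≤B , clique))
    where
    clique : ∀ u v → u ∈ₛ firstOf B k → v ∈ₛ firstOf B k → ¬ u ≡ v → Adjacent G u v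
    clique u v u∈ v∈ u≢v with adjacent? u v
    ... | yes u∼v = u∼v
    ... | no  u≁v = ⊥-elim (none (u , v , firstOf-⊆ B k u u∈ , firstOf-⊆ B k v v∈ , u≢v , u≁v))

  incident-two : ∀ i → countF (incident? G i) ≡ 2
  incident-two i = trans (count-∨ (end₁ i ≡ᵇ_) (end₂ i ≡ᵇ_) (allFin n) (All.universal disjoint _))
                         (cong₂ _+_ (countF-single′ (end₁ i)) (countF-single′ (end₂ i)))
    where
    disjoint : ∀ v → (end₁ i ≡ᵇ v) ∧ (end₂ i ≡ᵇ v) ≡ false
    disjoint v with end₁ i F.≟ v | end₂ i F.≟ v
    ... | yes refl | yes e = ⊥-elim (joins-≢ {i} (inj₁ refl) e)
    ... | yes _    | no  _ = refl
    ... | no  _    | _     = refl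

  incident-end₁ : ∀ i → incident? G i (end₁ i) ≡ true
  incident-end₁ i rewrite ≡ᵇ-refl (end₁ i) = refl

  incident-end₂ : ∀ i → incident? G i (end₂ i) ≡ true
  incident-end₂ i rewrite ≡ᵇ-refl (end₂ i) = ∨-zeroʳ _

  incident-∧ : (c : Bool) (v : Fin n) → countF (λ i → incident? G i v ∧ c) ≡ 𝟙 c * degree G v
  incident-∧ true  v = trans (count-cong (allFin (m G)) (λ i → ∧-identityʳ (incident? G i v))) (sym (*-identityˡ _))
  incident-∧ false v = trans (count-cong (allFin (m G)) (λ i → ∧-zeroʳ (incident? G i v))) (count-const false (allFin (m G)))

module _ {n : ℕ} (G : SimpleGraph n) (q : ℕ) where

  -- The two kinds of edges of H; edgesH G q is pendantEdges ++ incidenceEdges.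
  pendantEdges incidenceEdges : List (V G q × V G q)
  pendantEdges   = concatMap (λ i → map (λ t → (a i , p i t)) (allFin q)) (allFin (m G))
  incidenceEdges = concatMap (λ i → map (λ v → (a i , b v)) (filterᵇ (incident? G i) (allFin n))) (allFin (m G))

  data EdgeH : V G q → V G q → Set where
    pendant   : ∀ i t → EdgeH (a i) (p i t)
    incidence : ∀ i v → incident? G i v ≡ true → EdgeH (a i) (b v)

  edgeH-shape : ∀ {x y} → (x , y) ∈ edgesH G q → EdgeH x y
  edgeH-shape xy∈ with ∈-++⁻ pendantEdges xy∈
  ... | inj₁ xy∈₁ with find (∈-concatMap⁻ (λ i → map (λ t → (a i , p i t)) (allFin q)) {xs = allFin (m G)} xy∈₁)
  ...   | i , _ , xy∈ᵢ with ∈-map⁻ (λ t → (a i , p i t)) xy∈ᵢ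
  ...     | t , _ , refl = pendant i t
  edgeH-shape xy∈ | inj₂ xy∈₂
    with find (∈-concatMap⁻ (λ i → map (λ v → (a i , b v)) (filterᵇ (incident? G i) (allFin n))) {xs = allFin (m G)} xy∈₂)
  ...   | i , _ , xy∈ᵢ with ∈-map⁻ (λ v → (a i , b v)) xy∈ᵢ
  ...     | v , v∈ , refl = incidence i v (Equivalence.to T-≡ (proj₂ (∈-filter⁻ (T? ∘ incident? G i) {xs = allFin n} v∈)))

  incidence-∈ : ∀ i v → incident? G i v ≡ true → (a i , b v) ∈ edgesH G q
  incidence-∈ i v inc = ∈-++⁺ʳ pendantEdges (∈-concatMap⁺ (λ i → map (λ v → (a i , b v)) (filterᵇ (incident? G i) (allFin n)))
    (lose (∈-allFin i) (∈-map⁺ (λ v → (a i , b v)) (∈-filter⁺ (T? ∘ incident? G i) (∈-allFin v) (Equivalence.from T-≡ inc)))))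

  independent-by-shape : (I : VSet G q) → (∀ {x y} → EdgeH x y → ¬ (I x ≡ true × I y ≡ true)) → Independent G q I
  independent-by-shape I noEdge xy∈ = noEdge (edgeH-shape xy∈)

  inA inΠ : VSet G q → ℕ
  inA I = countF (I ∘ a)
  inΠ I = sumL (λ i → countF (I ∘ p i)) (allFin (m G))

  traceβ : VSet G q → Fin n → Bool
  traceβ I v = I (b v)

  size-split : (I : VSet G q) → size G q I ≡ inA I + (sizeβ G q I + inΠ I)
  size-split I =
    trans (count-++ I (map a (allFin (m G))) _) (cong₂ _+_ (count-map I a (allFin (m G)))
      (trans (count-++ I (map b (allFin n)) _) (cong₂ _+_ (count-map I b (allFin n))
        (trans (count-concatMap I _ (allFin (m G))) (sumL-cong (allFin (m G)) (λ i → count-map I (p i) (allFin q)))))))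

  pendant-at-A : (I : VSet G q) → count (I ∘ proj₁) pendantEdges ≡ inA I * q
  pendant-at-A I = count-fibres (I ∘ a) _ (I ∘ proj₁) q (allFin (m G))
    (λ i → trans (count-map (I ∘ proj₁) _ (allFin q)) (trans (count-const (I (a i)) (allFin q)) (cong (𝟙 (I (a i)) *_) (length-allFin q))))

  incidence-at-A : (I : VSet G q) → count (I ∘ proj₁) incidenceEdges ≡ inA I * 2
  incidence-at-A I = count-fibres (I ∘ a) _ (I ∘ proj₁) 2 (allFin (m G))
    (λ i → trans (count-map (I ∘ proj₁) _ (filterᵇ (incident? G i) (allFin n)))
             (trans (count-const (I (a i)) (filterᵇ (incident? G i) (allFin n))) (cong (𝟙 (I (a i)) *_) (incident-two G i))))

  pendant-at-Π : (I : VSet G q) → count (I ∘ proj₂) pendantEdges ≡ inΠ I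
  pendant-at-Π I = trans (count-concatMap (I ∘ proj₂) _ (allFin (m G)))
                         (sumL-cong (allFin (m G)) (λ i → count-map (I ∘ proj₂) _ (allFin q)))

  -- Double counting the pairs (e_i, v) with v ∈ I ∩ β incident to e_i.
  incidence-at-β : (r : ℕ) → Regular G r → (I : VSet G q) → count (I ∘ proj₂) incidenceEdges ≡ sizeβ G q I * r
  incidence-at-β r reg I = begin
    count (I ∘ proj₂) incidenceEdges
      ≡⟨ count-concatMap (I ∘ proj₂) _ (allFin (m G)) ⟩
    sumL (λ i → count (I ∘ proj₂) (map (λ v → (a i , b v)) (filterᵇ (incident? G i) (allFin n)))) (allFin (m G))
      ≡⟨ sumL-cong (allFin (m G)) (λ i → trans (count-map (I ∘ proj₂) (λ v → (a i , b v)) (filterᵇ (incident? G i) (allFin n)))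
                                               (count-filter (traceβ I) (incident? G i) (allFin n))) ⟩
    sumL (λ i → countF (λ v → incident? G i v ∧ I (b v))) (allFin (m G))
      ≡⟨ double-count (λ i v → incident? G i v ∧ I (b v)) (allFin (m G)) (allFin n) ⟩
    sumL (λ v → countF (λ i → incident? G i v ∧ I (b v))) (allFin n)
      ≡⟨ sumL-cong (allFin n) (λ v → trans (incident-∧ G (I (b v)) v) (cong (𝟙 (I (b v)) *_) (reg v))) ⟩
    sumL (λ v → 𝟙 (I (b v)) * r) (allFin n)
      ≡⟨ sumL-* r (𝟙 ∘ traceβ I) (allFin n) ⟩
    sumL (𝟙 ∘ traceβ I) (allFin n) * r
      ≡⟨ cong (_* r) (count≡sum (traceβ I) (allFin n)) ⟨
    sizeβ G q I * r ∎
    where open ≡-Reasoning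

  -- ‖I‖ = α q + 2α + π + β r for an independent set I: no edge of H is
  -- counted twice, so ‖I‖ splits into edges counted at either end.
  norm-split : (r : ℕ) → Regular G r → (I : VSet G q) → Independent G q I →
               ‖_‖ G q I ≡ (inA I * q + inA I * 2) + (inΠ I + sizeβ G q I * r)
  norm-split r reg I ind =
    trans (count-∨ (I ∘ proj₁) (I ∘ proj₂) (edgesH G q) (All.tabulate (λ xy∈ → notBoth (ind xy∈))))
      (cong₂ _+_ (trans (count-++ (I ∘ proj₁) pendantEdges incidenceEdges) (cong₂ _+_ (pendant-at-A I) (incidence-at-A I)))
                 (trans (count-++ (I ∘ proj₂) pendantEdges incidenceEdges) (cong₂ _+_ (pendant-at-Π I) (incidence-at-β r reg I))))
    where
    notBoth : ∀ {x y} → ¬ (x ≡ true × y ≡ true) → x ∧ y ≡ false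
    notBoth {true}  {true}  both = ⊥-elim (both (refl , refl))
    notBoth {true}  {false} _    = refl
    notBoth {false}         _    = refl

  -- Each a_i ∈ I has both β-neighbours outside I, i.e. e_i avoids I ∩ β.
  inA-≤-avoiding : (I : VSet G q) → Independent G q I → inA I ≤ avoiding G (traceβ I)
  inA-≤-avoiding I ind = count-≤ (I ∘ a) (Avoids G (traceβ I)) (allFin (m G)) avoids
    where
    outside : ∀ {c} → ¬ c ≡ true → not c ≡ true
    outside {true}  c∉ = ⊥-elim (c∉ refl)
    outside {false} _  = refl
    avoids : ∀ i → I (a i) ≡ true → Avoids G (traceβ I) i ≡ true
    avoids i aᵢ∈ = cong₂ _∧_ (outside (λ e → ind (incidence-∈ i _ (incident-end₁ G i)) (aᵢ∈ , e)))
                             (outside (λ e → ind (incidence-∈ i _ (incident-end₂ G i)) (aᵢ∈ , e)))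

  -- Room for pendant vertices next to a_i: all q of them when a_i is left out
  -- (e_i meets B), none when a_i is taken (e_i avoids B).
  pendantRoom : (Fin n → Bool) → Fin (m G) → ℕ
  pendantRoom B i = 𝟙 (not (Avoids G B i)) * q

  pendantRoom-total : (B : Fin n → Bool) → sumL (pendantRoom B) (allFin (m G)) + avoiding G B * q ≡ m G * q
  pendantRoom-total B = begin
    sumL (pendantRoom B) (allFin (m G)) + avoiding G B * q
      ≡⟨ cong (_+ avoiding G B * q) (trans (sumL-* q _ (allFin (m G))) (cong (_* q) (sym (count≡sum _ (allFin (m G)))))) ⟩
    countF (not ∘ Avoids G B) * q + avoiding G B * q
      ≡⟨ *-distribʳ-+ q (countF (not ∘ Avoids G B)) _ ⟨
    (countF (not ∘ Avoids G B) + avoiding G B) * q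
      ≡⟨ cong (_* q) (trans (+-comm _ (avoiding G B)) (sym (count-split (λ _ → true) (Avoids G B) (allFin (m G))))) ⟩
    count (λ _ → true) (allFin (m G)) * q
      ≡⟨ cong (_* q) (trans (count-const true (allFin (m G))) (trans (*-identityˡ _) (length-allFin (m G)))) ⟩
    m G * q ∎
    where open ≡-Reasoning

  -- The extremal independent set: I ∩ β = B, I ∩ A = {a_i : e_i avoids B},
  -- and N pendant vertices placed greedily next to the a_i left out.
  extremal : (Fin n → Bool) → ℕ → VSet G q
  extremal B N (a i)   = Avoids G B i
  extremal B N (b v)   = B v
  extremal B N (p i t) = toℕ t <ᵇ fill (pendantRoom B) N i

  extremal-independent : (B : Fin n → Bool) (N : ℕ) → Independent G q (extremal B N)
  extremal-independent B N = independent-by-shape (extremal B N) noEdge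
    where
    noRoom : ∀ i → Avoids G B i ≡ true → ∀ t → (toℕ t <ᵇ fill (pendantRoom B) N i) ≡ false
    noRoom i avoids t with fill (pendantRoom B) N i | fill-≤ (pendantRoom B) N i
    ... | zero  | _ = refl
    ... | suc _ | room rewrite avoids = ⊥-elim (n≮0 room)
    noEdge : ∀ {x y} → EdgeH x y → ¬ (extremal B N x ≡ true × extremal B N y ≡ true)
    noEdge (pendant i t) (avoids , pᵢₜ∈) with () ← trans (sym (noRoom i avoids t)) pᵢₜ∈
    noEdge (incidence i v inc) (avoids , v∈) with joins-other G i v inc
    ... | inj₁ e = endOutside (subst (λ uw → not (B (proj₁ uw)) ∧ not (B (proj₂ uw)) ≡ true) e avoids)
      where
      endOutside : not (B v) ∧ not (B (other G i v)) ≡ true → ⊥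
      endOutside h rewrite v∈ with () ← h
    ... | inj₂ e = endOutside (subst (λ uw → not (B (proj₁ uw)) ∧ not (B (proj₂ uw)) ≡ true) e avoids)
      where
      endOutside : not (B (other G i v)) ∧ not (B v) ≡ true → ⊥
      endOutside h rewrite v∈ | ∧-zeroʳ (not (B (other G i v))) with () ← h

  extremal-inΠ : (B : Fin n → Bool) (N : ℕ) → N ≤ sumL (pendantRoom B) (allFin (m G)) → inΠ (extremal B N) ≡ N
  extremal-inΠ B N fits = trans (sumL-cong (allFin (m G)) placed) (fill-total (pendantRoom B) N fits)
    where
    room≤q : ∀ c → 𝟙 c * q ≤ q
    room≤q true  = ≤-reflexive (*-identityˡ q)
    room≤q false = z≤n
    placed : ∀ i → countF (extremal B N ∘ p i) ≡ fill (pendantRoom B) N i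
    placed i = countF-initial q _ (≤-trans (fill-≤ (pendantRoom B) N i) (room≤q (not (Avoids G B i))))

allVecs : (k : ℕ) → List (Vec Bool k)
allVecs zero    = [] ∷ []
allVecs (suc k) = map (true ∷_) (allVecs k) ++ map (false ∷_) (allVecs k)

allVecs-complete : (k : ℕ) (V : Vec Bool k) → V ∈ allVecs k
allVecs-complete zero    []        = Any.here refl
allVecs-complete (suc k) (true ∷ V)  = ∈-++⁺ˡ (∈-map⁺ (true ∷_) (allVecs-complete k V))
allVecs-complete (suc k) (false ∷ V) = ∈-++⁺ʳ (map (true ∷_) (allVecs k)) (∈-map⁺ (false ∷_) (allVecs-complete k V))

module _ {n : ℕ} (G : SimpleGraph n) where

  setsOfSize : ℕ → List (Vec Bool n)
  setsOfSize j = filter (λ V → countF (lookup V) ≟ j) (allVecs n)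

  initialSet : ℕ → Vec Bool n
  initialSet j = Vec.tabulate (λ w → toℕ w <ᵇ j)

  bestSet : ℕ → Fin n → Bool
  bestSet j = lookup (argmax (avoiding G ∘ lookup) (initialSet j) (setsOfSize j))

  maxAvoiding : ℕ → ℕ
  maxAvoiding j = avoiding G (bestSet j)

  -- bestSet j is indeed a j-set (the list of candidates is non-empty as j ≤ n)
  bestSet-size : (j : ℕ) → j ≤ n → countF (bestSet j) ≡ j
  bestSet-size j j≤n = argmax-all (avoiding G ∘ lookup) {P = λ V → countF (lookup V) ≡ j} initialSize
    (All.tabulate (λ V∈ → proj₂ (∈-filter⁻ (λ V → countF (lookup V) ≟ j) {xs = allVecs n} V∈)))
    where
    initialSize : countF (lookup (initialSet j)) ≡ j
    initialSize = trans (count-cong (allFin n) (lookup∘tabulate _)) (countF-initial n j j≤n)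

  maxAvoiding-max : (j : ℕ) (B : Fin n → Bool) → countF B ≡ j → avoiding G B ≤ maxAvoiding j
  maxAvoiding-max j B size = subst (_≤ maxAvoiding j) (avoiding-cong G (lookup∘tabulate B))
    (All.lookup (f[xs]≤f[argmax] {f = avoiding G ∘ lookup} (initialSet j) (setsOfSize j))
      (∈-filter⁺ (λ V → countF (lookup V) ≟ j) (allVecs-complete n (Vec.tabulate B))
        (trans (count-cong (allFin n) (lookup∘tabulate B)) size)))

  -- Without a k-clique, c_{j+1} + 2 ≤ c_j for k ≤ j < r: the best set of size
  -- j+1 has a vertex v with a non-neighbour in it, and deleting v helps.
  maxAvoiding-step : (r k : ℕ) → Regular G r → ¬ HasClique G k → r ≤ n →
                     (j : ℕ) → k ≤ j → j < r → maxAvoiding (suc j) + 2 ≤ maxAvoiding j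
  maxAvoiding-step r k reg noClique r≤n j k≤j j<r =
    fromPair (nonadjacent-pair G k B (subst (k ≤_) (sym B-size) (m≤n⇒m≤1+n k≤j)) noClique)
    where
    B : Fin n → Bool
    B = bestSet (suc j)
    B-size : countF B ≡ suc j
    B-size = bestSet-size (suc j) (≤-trans j<r r≤n)
    fromPair : ∃₂ (NonadjacentIn G B) → maxAvoiding (suc j) + 2 ≤ maxAvoiding j
    fromPair (u , v , Bu , Bv , u≢v , u≁v) = ≤-trans gain (maxAvoiding-max j (B ─ v) (countF-─-size B v Bv B-size))
      where
      small : 2 + innerDegree G B v ≤ r
      small = ≤-trans (subst (suc (suc (innerDegree G B v)) ≤_) B-size (innerDegree-<-nonadjacent G B u v Bu Bv u≢v u≁v)) j<r
      gain : avoiding G B + 2 ≤ avoiding G (B ─ v)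
      gain = +-cancelʳ-≤ r _ _ (subst (_≤ avoiding G (B ─ v) + r) (xy∙z≈xz∙y (avoiding G B) r 2)
               (avoiding-─-≤ G r reg B v Bv 2 r small))

  -- Without a k-clique, c_k < x = m - (kr - C(k,2)): the strict counting bound
  -- applied to the best set of size k.
  maxAvoiding-<-x : (r k : ℕ) → Regular G r → ¬ HasClique G k → 0 < k → k ≤ r → r ≤ n →
                    suc (maxAvoiding k) ≤ xval (m G) k r
  maxAvoiding-<-x r k@(suc t) reg noClique _ k≤r r≤n =
    fromPair (nonadjacent-pair G k (bestSet k) (≤-reflexive (sym B-size)) noClique)
    where
    B-size : countF (bestSet k) ≡ k
    B-size = bestSet-size k (≤-trans k≤r r≤n)
    fromPair : ∃₂ (NonadjacentIn G (bestSet k)) → suc (maxAvoiding k) ≤ xval (m G) k r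
    fromPair (u , v , Bu , Bv , u≢v , u≁v) = m+n≤o⇒m≤o∸n (suc (maxAvoiding k)) (+-cancelʳ-≤ (k C 2) _ _ (begin
      suc (maxAvoiding k) + (k * r ∸ k C 2) + k C 2  ≡⟨ +-assoc (suc (maxAvoiding k)) _ (k C 2) ⟩
      suc (maxAvoiding k) + (k * r ∸ k C 2 + k C 2)  ≡⟨ cong (λ z → suc (maxAvoiding k + z)) (m∸n+n≡m (choose2-≤ r k (m≤n⇒m≤1+n k≤r))) ⟩
      suc (maxAvoiding k + k * r)                    ≤⟨ avoiding-bound-strict G r reg t (bestSet k) u v B-size Bu Bv u≢v u≁v ⟩
      m G + k C 2                                    ∎))
      where open ≤-Reasoning

-- ‖I‖ = α(q+2) + π + βr for an independent set with α vertices in A, π in Π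
-- and β in β (see norm-split).
weight : (q r α π β : ℕ) → ℕ
weight q r α π β = α * q + α * 2 + (π + β * r)

weight-exchange : (q r α π γ N β : ℕ) → α ≤ γ → α + π ≡ γ + N → weight q r α π β ≤ weight q r γ N β
weight-exchange q r α π γ N β α≤γ total with m≤n⇒∃[o]m+o≡n α≤γ
... | d , refl = begin
  weight q r α π β                      ≡⟨ cong (λ z → weight q r α z β) π≡d+N ⟩
  weight q r α (d + N) β                ≤⟨ m≤m+n _ (d * q + d) ⟩
  weight q r α (d + N) β + (d * q + d)  ≡⟨ regroup α d q N β r ⟩
  weight q r (α + d) N β                ∎
  where
  open ≤-Reasoning
  π≡d+N : π ≡ d + N
  π≡d+N = +-cancelˡ-≡ α π (d + N) (trans total (+-assoc α d N))
  regroup : ∀ α d q N β r → α * q + α * 2 + (d + N + β * r) + (d * q + d)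
                          ≡ (α + d) * q + (α + d) * 2 + (N + β * r)
  regroup = solve-∀

-- One step along the sequence: one more β-vertex and at least two fewer
-- A-vertices at the same total size lower the weight, provided r ≤ 2q + 2.
weight-step : (q r γ′ γ N′ N j : ℕ) → γ′ + 2 ≤ γ → N′ + (suc j + γ′) ≡ N + (j + γ) → r ≤ q + q + 2 →
              weight q r γ′ N′ (suc j) < weight q r γ N j
weight-step q r γ′ γ N′ N j drop total r≤2q+2 with m≤n⇒∃[o]m+o≡n drop | m≤n⇒∃[o]m+o≡n r≤2q+2
... | d , refl | e , r+e≡2q+2 = begin-strict
  weight q r γ′ N′ (suc j)                              ≡⟨ cong (λ z → weight q r γ′ z (suc j)) N′≡ ⟩
  weight q r γ′ (N + 1 + d) (suc j)                     <⟨ m<m+n _ (s≤s z≤n) ⟩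
  weight q r γ′ (N + 1 + d) (suc j) + suc (e + d * q + d) ≡⟨ before γ′ q N j r d e ⟩
  base + (r + e)                                        ≡⟨ cong (base +_) r+e≡2q+2 ⟩
  base + (q + q + 2)                                    ≡⟨ after γ′ q N j r d ⟨
  weight q r (γ′ + 2 + d) N j                           ∎
  where
  open ≤-Reasoning
  base : ℕ
  base = γ′ * q + γ′ * 2 + N + j * r + 2 * d + d * q + 2
  N′≡ : N′ ≡ N + 1 + d
  N′≡ = +-cancelʳ-≡ (suc j + γ′) N′ (N + 1 + d) (trans total (rearrange N j γ′ d))
    where
    rearrange : ∀ N j γ′ d → N + (j + (γ′ + 2 + d)) ≡ N + 1 + d + (suc j + γ′)
    rearrange = solve-∀
  before : ∀ γ′ q N j r d e → γ′ * q + γ′ * 2 + (N + 1 + d + (1 + j) * r) + suc (e + d * q + d)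
                              ≡ γ′ * q + γ′ * 2 + N + j * r + 2 * d + d * q + 2 + (r + e)
  before = solve-∀
  after : ∀ γ′ q N j r d → (γ′ + 2 + d) * q + (γ′ + 2 + d) * 2 + (N + j * r)
                           ≡ γ′ * q + γ′ * 2 + N + j * r + 2 * d + d * q + 2 + (q + q + 2)
  after = solve-∀

weight-final : (q r γ N x k : ℕ) → suc γ ≤ x → N + γ ≡ x → weight q r γ N k < k * r + x * (q + 2)
weight-final q r γ N x k γ<x total with m≤n⇒∃[o]m+o≡n γ<x
... | d , refl = begin-strict
  weight q r γ N k                        ≡⟨ cong (λ z → weight q r γ z k) N≡ ⟩
  weight q r γ (suc d) k                  <⟨ m<m+n _ (s≤s z≤n) ⟩
  weight q r γ (suc d) k + suc (q + d * q + d) ≡⟨ regroup γ d q k r ⟩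
  k * r + (suc γ + d) * (q + 2)           ∎
  where
  open ≤-Reasoning
  N≡ : N ≡ suc d
  N≡ = +-cancelʳ-≡ γ N (suc d) (trans total (cong suc (+-comm γ d)))
  regroup : ∀ γ d q k r → γ * q + γ * 2 + (1 + d + k * r) + suc (q + d * q + d) ≡ k * r + (1 + γ + d) * (q + 2)
  regroup = solve-∀

drop-by-two : (c : ℕ → ℕ) (k r : ℕ) → (∀ j → k ≤ j → j < r → c (suc j) + 2 ≤ c j) →
              ∀ i → k + i ≤ r → c (k + i) + 2 * i ≤ c k
drop-by-two c k r step zero    _       = ≤-reflexive (trans (+-identityʳ _) (cong c (+-identityʳ k)))
drop-by-two c k r step (suc i) k+i+1≤r = begin
  c (k + suc i) + 2 * suc i    ≡⟨ trans (cong₂ _+_ (cong c (+-suc k i)) (*-suc 2 i)) (sym (+-assoc _ 2 (2 * i))) ⟩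
  c (suc (k + i)) + 2 + 2 * i  ≤⟨ +-monoˡ-≤ (2 * i) (step (k + i) (m≤m+n k i) k+i<r) ⟩
  c (k + i) + 2 * i            ≤⟨ drop-by-two c k r step i (<⇒≤ k+i<r) ⟩
  c k                          ∎
  where
  open ≤-Reasoning
  k+i<r : k + i < r
  k+i<r = subst (_≤ r) (+-suc k i) k+i+1≤r

module Sequence {n : ℕ} (G : SimpleGraph n) (r k : ℕ) (reg : Regular G r) (noClique : ¬ HasClique G k)
                (0<k : 0 < k) (k≤r : k ≤ r) (r≤n : r ≤ n) (4≤r : 4 ≤ r) where

  q x : ℕ
  q = r ∸ 3
  x = xval (m G) k r

  c : ℕ → ℕ
  c = maxAvoiding G

  -- the number of pendant vertices that completes j + c_j to size k + x
  N : ℕ → ℕ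
  N j = (k + x) ∸ (j + c j)

  s : ℕ → ℕ
  s j = weight q r (c j) (N j) j

  q+3≡r : q + 3 ≡ r
  q+3≡r = m∸n+n≡m (≤-trans (n≤1+n 3) 4≤r)

  1≤q : 1 ≤ q
  1≤q = +-cancelʳ-≤ 3 1 q (subst (4 ≤_) (sym q+3≡r) 4≤r)

  c<x : suc (c k) ≤ x
  c<x = maxAvoiding-<-x G r k reg noClique 0<k k≤r r≤n

  -- j + c_j ≤ k + x, so that N_j really completes the size.
  budget : ∀ j → k ≤ j → j ≤ r → j + c j ≤ k + x
  budget j k≤j j≤r with m≤n⇒∃[o]m+o≡n k≤j
  ... | i , refl = begin
    k + i + c (k + i)        ≤⟨ +-monoʳ-≤ (k + i) (m≤m+n (c (k + i)) i) ⟩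
    k + i + (c (k + i) + i)  ≤⟨ ≤-reflexive (xy∙z≈x∙zy k i _) ⟩
    k + (c (k + i) + i + i)  ≤⟨ +-monoʳ-≤ k (subst (_≤ c k) twice (drop-by-two c k r (maxAvoiding-step G r k reg noClique r≤n) i j≤r)) ⟩
    k + c k                  ≤⟨ +-monoʳ-≤ k (<⇒≤ c<x) ⟩
    k + x                    ∎
    where
    open ≤-Reasoning
    twice : c (k + i) + 2 * i ≡ c (k + i) + i + i
    twice = trans (cong (c (k + i) +_) (cong (i +_) (+-identityʳ i))) (sym (+-assoc _ i i))

  N-total : ∀ j → k ≤ j → j ≤ r → N j + (j + c j) ≡ k + x
  N-total j k≤j j≤r = m∸n+n≡m (budget j k≤j j≤r)

  -- The N_j pendant vertices fit next to the a_i left out by the best j-set: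
  -- N_j + c_j ≤ m and q ≥ 1.
  N-fits : ∀ j → k ≤ j → j ≤ r → N j ≤ sumL (pendantRoom G q (bestSet G j)) (allFin (m G))
  N-fits j k≤j j≤r = subst (N j ≤_) (trans (*-distribʳ-∸ q (m G) (c j)) (sym room))
                       (≤-trans (m+n≤o⇒m≤o∸n (N j) fewer) (m≤m*n (m G ∸ c j) q {{>-nonZero 1≤q}}))
    where
    room : sumL (pendantRoom G q (bestSet G j)) (allFin (m G)) ≡ m G * q ∸ c j * q
    room = trans (sym (m+n∸n≡m _ (c j * q))) (cong (_∸ c j * q) (pendantRoom-total G q (bestSet G j)))
    fewer : N j + c j ≤ m G
    fewer = +-cancelʳ-≤ j _ _ (begin
      N j + c j + j    ≡⟨ xy∙z≈x∙zy (N j) (c j) j ⟩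
      N j + (j + c j)  ≡⟨ N-total j k≤j j≤r ⟩
      k + x            ≤⟨ +-mono-≤ k≤j (m∸n≤m (m G) (k * r ∸ k C 2)) ⟩
      j + m G          ≡⟨ +-comm j (m G) ⟩
      m G + j          ∎)
      where open ≤-Reasoning

  s-attained : ∀ j → k ≤ j → j ≤ r → ∃ λ I → InFamily G q k x j I × ‖_‖ G q I ≡ s j
  s-attained j k≤j j≤r = I , (extremal-independent G q B (N j) , I-size , B-size) , I-norm
    where
    B : Fin n → Bool
    B = bestSet G j
    B-size : countF B ≡ j
    B-size = bestSet-size G j (≤-trans j≤r r≤n)
    I : VSet G q
    I = extremal G q B (N j)
    I-inΠ : inΠ G q I ≡ N j
    I-inΠ = extremal-inΠ G q B (N j) (N-fits j k≤j j≤r)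
    I-size : size G q I ≡ k + x
    I-size = begin
      size G q I                       ≡⟨ size-split G q I ⟩
      c j + (sizeβ G q I + inΠ G q I)  ≡⟨ cong₂ (λ y z → c j + (y + z)) B-size I-inΠ ⟩
      c j + (j + N j)                  ≡⟨ trans (x∙yz≈y∙xz (c j) j (N j)) (cong (j +_) (+-comm (c j) (N j))) ⟩
      j + (N j + c j)                  ≡⟨ x∙yz≈y∙xz j (N j) (c j) ⟩
      N j + (j + c j)                  ≡⟨ N-total j k≤j j≤r ⟩
      k + x                            ∎
      where open ≡-Reasoning
    I-norm : ‖_‖ G q I ≡ s j
    I-norm = trans (norm-split G q r reg I (extremal-independent G q B (N j)))
                   (cong₂ (λ y z → c j * q + c j * 2 + (z + y * r)) B-size I-inΠ)

  -- Every J ∈ 𝓘_j has ‖J‖ ≤ s_j: it has at most c_j A-vertices and the same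
  -- total number of A- and Π-vertices as the extremal set.
  s-upper : ∀ j → k ≤ j → j ≤ r → ∀ J → InFamily G q k x j J → ‖_‖ G q J ≤ s j
  s-upper j k≤j j≤r J (J-ind , J-size , J-sizeβ) =
    subst (_≤ s j) (sym J-norm)
      (weight-exchange q r (inA G q J) (inΠ G q J) (c j) (N j) j
        (≤-trans (inA-≤-avoiding G q J J-ind) (maxAvoiding-max G j (traceβ G q J) J-sizeβ))
        (+-cancelˡ-≡ j _ _ sameSize))
    where
    J-norm : ‖_‖ G q J ≡ weight q r (inA G q J) (inΠ G q J) j
    J-norm = trans (norm-split G q r reg J J-ind)
                   (cong (λ z → inA G q J * q + inA G q J * 2 + (inΠ G q J + z * r)) J-sizeβ)
    sameSize : j + (inA G q J + inΠ G q J) ≡ j + (c j + N j)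
    sameSize = begin
      j + (inA G q J + inΠ G q J)            ≡⟨ x∙yz≈y∙xz j (inA G q J) (inΠ G q J) ⟩
      inA G q J + (j + inΠ G q J)            ≡⟨ cong (λ z → inA G q J + (z + inΠ G q J)) J-sizeβ ⟨
      inA G q J + (sizeβ G q J + inΠ G q J)  ≡⟨ size-split G q J ⟨
      size G q J                             ≡⟨ J-size ⟩
      k + x                                  ≡⟨ N-total j k≤j j≤r ⟨
      N j + (j + c j)                        ≡⟨ trans (x∙yz≈y∙xz (N j) j (c j)) (cong (j +_) (+-comm (N j) (c j))) ⟩
      j + (c j + N j)                        ∎
      where open ≡-Reasoning

  s-isMax : ∀ j → k ≤ j → j ≤ r → IsMaxS G q k x j (s j)
  s-isMax j k≤j j≤r = s-attained j k≤j j≤r , s-upper j k≤j j≤r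

  -- s_{j+1} < s_j: one more β-vertex costs r, two fewer A-vertices save 2(q+1)
  s-decreasing : ∀ j → k ≤ j → j < r → s (suc j) < s j
  s-decreasing j k≤j j<r =
    weight-step q r (c (suc j)) (c j) (N (suc j)) (N j) j (maxAvoiding-step G r k reg noClique r≤n j k≤j j<r)
      (trans (N-total (suc j) (m≤n⇒m≤1+n k≤j) j<r) (sym (N-total j k≤j (<⇒≤ j<r)))) r≤2q+2
    where
    r≤2q+2 : r ≤ q + q + 2
    r≤2q+2 = subst (_≤ q + q + 2) (trans (+-assoc q 1 2) q+3≡r) (+-monoˡ-≤ 2 (+-monoʳ-≤ q 1≤q))

  -- s_k < kr + x(r-1), since c_k < x
  s-final : s k < k * r + x * (r ∸ 1)
  s-final = subst (λ z → s k < k * r + x * z) (sym r∸1≡q+2)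
              (weight-final q r (c k) (N k) x k c<x (+-cancelˡ-≡ k _ _ (trans (x∙yz≈y∙xz k (N k) (c k)) (N-total k ≤-refl k≤r))))
    where
    r∸1≡q+2 : r ∸ 1 ≡ q + 2
    r∸1≡q+2 = trans (cong (_∸ 1) (trans (sym q+3≡r) (sym (+-assoc q 2 1)))) (m+n∸n≡m (q + 2) 1)

lemma4 : (n r k : ℕ) → 11 < n → r ≡ n ∸ 4
         → (G : SimpleGraph n) → Regular G r
         → 0 < k → 2 * k < n → ¬ HasClique G k
         → Σ (ℕ → ℕ) (λ s → (∀ i → i ≤ r ∸ k → IsMaxS G (r ∸ 3) k (xval (m G) k r) (k + i) (s (k + i)))
                  × (∀ j → k ≤ j → j < r → s (suc j) < s j)
                  × s k < k * r + xval (m G) k r * (r ∸ 1))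
lemma4 n r k 11<n r≡n∸4 G reg 0<k 2k<n noClique =
  s , (λ i i≤r∸k → s-isMax (k + i) (m≤m+n k i) (subst (k + i ≤_) (m+[n∸m]≡n k≤r) (+-monoʳ-≤ k i≤r∸k)))
    , s-decreasing , s-final
  where
  4≤n : 4 ≤ n
  4≤n = ≤-trans (s≤s (s≤s (s≤s (s≤s z≤n)))) 11<n
  r+4≡n : r + 4 ≡ n
  r+4≡n = trans (cong (_+ 4) r≡n∸4) (m∸n+n≡m 4≤n)
  4≤r : 4 ≤ r
  4≤r = subst (4 ≤_) (sym r≡n∸4) (≤-trans (s≤s (s≤s (s≤s (s≤s z≤n)))) (∸-monoˡ-≤ 4 11<n))
  r≤n : r ≤ n
  r≤n = subst (r ≤_) r+4≡n (m≤m+n r 4)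
  -- 2k ≤ r + 3 ≤ 2r
  k≤r : k ≤ r
  k≤r = *-cancelˡ-≤ 2 (≤-trans (≤-pred (subst (2 * k <_) (trans (sym r+4≡n) (+-suc r 3)) 2k<n))
                               (subst (r + 3 ≤_) (cong (r +_) (sym (+-identityʳ r))) (+-monoʳ-≤ r (≤-trans (n≤1+n 3) 4≤r))))
  open Sequence G r k reg noClique 0<k k≤r r≤n 4≤r
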